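{- Let $N>1$ be an integer. For each integer $n$ with $0\le n\le N$ and $\gcd(N,n)>1$, the point $z=n/N$ lies on the boundary of $\mathcal{R}_N$.
   Context: For $\alpha\in\mathbb{C}$ and $r\ge 0$ let $D(\alpha,r)=\{z\in\mathbb{C}: |z-\alpha|\le r\}$. For a rational number $a/b\in[0,1]$ in lowest terms ($b>0$, $\gcd(a,b)=1$) let $D_{a/b}=D(a/b,1/b)$. For an integer $N>1$ let $\mathcal{R}_N=\bigcup D_{a/b}$, the union over all rationals $a/b\in[0,1]$ in lowest terms with $N\mid b$. -}

module Defs where

open import Data.Nat as ℕ using (ℕ; zero; suc)
open import Data.Nat.Divisibility using (_∣_)
open import Data.Nat.Coprimality using (Coprime)
open import Data.Integer using (+_)
open import Data.Rational using (ℚ; 0ℚ; _+_; _-_; _*_; _≤_; _<_; _/_)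
open import Data.Product using (Σ; ∃; _×_)
open import Relation.Nullary using (¬_)

-- The rational number a/b (for b > 0); value at b = 0 is junk and never used,
-- since every use below is guarded by 0 < b.
frac : ℕ → ℕ → ℚ
frac a zero    = 0ℚ
frac a (suc k) = (+ a) / suc k

-- Points of ℂ are represented by (x , y) ↦ x + i y with x y rational.
-- Squared distance |z - w|² between x₁ + i y₁ and x₂ + i y₂.
dist² : ℚ → ℚ → ℚ → ℚ → ℚ
dist² x₁ y₁ x₂ y₂ = (x₁ - x₂) * (x₁ - x₂) + (y₁ - y₂) * (y₁ - y₂)

InDisk : ℕ → ℕ → ℚ → ℚ → Set
InDisk a b x y = dist² x y (frac a b) 0ℚ ≤ frac 1 b * frac 1 b

LowestIn01 : ℕ → ℕ → Set
LowestIn01 a b = (0 ℕ.< b) × (a ℕ.≤ b) × Coprime a b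

Inℛ : ℕ → ℚ → ℚ → Set
Inℛ N x y = ∃ λ a → ∃ λ b → LowestIn01 a b × (N ∣ b) × InDisk a b x y

-- The real point z = x₀ (x₀ ∈ ℚ) lies on the boundary of ℛ_N:
-- every open disc of radius ε > 0 around z meets ℛ_N and meets its complement.
-- (Witnesses are taken with Gaussian-rational coordinates.)
OnBoundaryℛ : ℕ → ℚ → Set
OnBoundaryℛ N x₀ =
  (ε : ℚ) → 0ℚ < ε →
    (∃ λ x → ∃ λ y → (dist² x y x₀ 0ℚ < ε * ε) × Inℛ N x y)
  × (∃ λ x → ∃ λ y → (dist² x y x₀ 0ℚ < ε * ε) × ¬ Inℛ N x y)

{-# OPTIONS --safe #-}

-- With b = k N the offset n/N - a/b equals (k n - a)/b, so x + i y lies in D_{a/b} exactly when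
-- (k n - a)² + (b y)² ≤ 1.  For y > 0 this forces a = k n, and then gcd(N, n) divides both a and
-- b = k N, contradicting gcd(a, b) = 1: no point straight above n/N lies in ℛ_N.  On the other hand
-- n/N lies on the circle bounding D_{a/N²} for a = N n ± 1, which is coprime to N².

module Submission where

open import Defs
open import Data.Nat as ℕ using (ℕ; zero; suc; NonZero)
import Data.Nat.Properties as ℕₚ
open import Data.Nat.Coprimality as Coprimality using (Coprime; coprime-divisor; coprime⇒gcd≡1)
open import Data.Nat.Divisibility using (_∣_; divides; ∣-refl; ∣-trans; ∣1⇒≡1; ∣m+n∣m⇒∣n; m∣m*n; n∣m*n)
open import Data.Nat.GCD using (gcd)
open import Data.Integer as ℤ using (ℤ; +_; 0ℤ; 1ℤ; -1ℤ; -[1+_])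
import Data.Integer.Properties as ℤₚ
open import Data.Integer.Tactic.RingSolver using (solve-∀)
open import Data.Rational as ℚ using (ℚ; 0ℚ; _+_; _-_; _*_; _≤_; _<_; toℚᵘ)
import Data.Rational.Properties as ℚₚ
open import Data.Rational.Unnormalised as ℚᵘ using (mkℚᵘ; *≡*; *≤*) renaming (_≃_ to _≃ᵘ_)
import Data.Rational.Unnormalised.Properties as ℚᵘₚ
open import Data.Product using (_,_)
open import Data.Sum using (inj₁; inj₂)
open import Relation.Nullary using (¬_; contradiction)
open import Relation.Binary.PropositionalEquality

coprime-∣ : ∀ {m n a b} → m ∣ a → n ∣ b → Coprime a b → Coprime m n
coprime-∣ m∣a n∣b a⊥b (d∣m , d∣n) = a⊥b (∣-trans d∣m m∣a , ∣-trans d∣n n∣b)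

coprime-* : ∀ {m n o} → Coprime m n → Coprime m o → Coprime m (n ℕ.* o)
coprime-* m⊥n m⊥o (d∣m , d∣no) = m⊥o (d∣m , coprime-divisor (coprime-∣ d∣m ∣-refl m⊥n) d∣no)

∣⇒coprime-suc : ∀ {m n} → n ∣ m → Coprime (suc m) n
∣⇒coprime-suc {m} n∣m {d} (d∣1+m , d∣n) =
  ∣1⇒≡1 (∣m+n∣m⇒∣n (subst (d ∣_) (ℕₚ.+-comm 1 m) d∣1+m) (∣-trans d∣n n∣m))

/-sub-/ : ∀ p q d .{{_ : NonZero d}} → p ℚᵘ./ d ℚᵘ.- q ℚᵘ./ d ≃ᵘ (p ℤ.- q) ℚᵘ./ d
/-sub-/ p q (suc d) = *≡* (begin
  (p ℤ.* D ℤ.+ ℤ.- q ℤ.* D) ℤ.* D  ≡⟨ cong (ℤ._* D) (ℤₚ.*-distribʳ-+ D p (ℤ.- q)) ⟨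
  (p ℤ.- q) ℤ.* D ℤ.* D            ≡⟨ ℤₚ.*-assoc (p ℤ.- q) D D ⟩
  (p ℤ.- q) ℤ.* (D ℤ.* D)          ∎)
  where
  open ≡-Reasoning
  D = + suc d

/-square-mono-≤ : ∀ {i j} d .{{_ : NonZero d}} → i ℤ.* i ℤ.≤ j ℤ.* j →
                  (i ℚᵘ./ d) ℚᵘ.* (i ℚᵘ./ d) ℚᵘ.≤ (j ℚᵘ./ d) ℚᵘ.* (j ℚᵘ./ d)
/-square-mono-≤ (suc d) i²≤j² = *≤* (ℤₚ.*-monoʳ-≤-nonNeg (+ suc d ℤ.* + suc d) i²≤j²)

toℚᵘ-frac : ∀ n d .{{_ : NonZero d}} → toℚᵘ (frac n d) ≃ᵘ + n ℚᵘ./ d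
toℚᵘ-frac n (suc d) = ℚₚ.toℚᵘ-fromℚᵘ (mkℚᵘ (+ n) d)

toℚᵘ-homo-sub : ∀ p q → toℚᵘ (p - q) ≃ᵘ toℚᵘ p ℚᵘ.- toℚᵘ q
toℚᵘ-homo-sub p q =
  ℚᵘₚ.≃-trans (ℚₚ.toℚᵘ-homo-+ p (ℚ.- q)) (ℚᵘₚ.+-congʳ (toℚᵘ p) (ℚₚ.toℚᵘ-homo‿- q))

toℚᵘ-frac-offset : ∀ n a k {N b} .{{_ : NonZero N}} .{{_ : NonZero b}} → b ≡ k ℕ.* N →
                   toℚᵘ (frac n N - frac a b) ≃ᵘ (+ k ℤ.* + n ℤ.- + a) ℚᵘ./ b
toℚᵘ-frac-offset n a (suc k) {N@(suc _)} {b@(suc _)} refl = begin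
  toℚᵘ (frac n N - frac a b)
    ≈⟨ toℚᵘ-homo-sub (frac n N) (frac a b) ⟩
  toℚᵘ (frac n N) ℚᵘ.- toℚᵘ (frac a b)
    ≈⟨ ℚᵘₚ.+-cong (toℚᵘ-frac n N) (ℚᵘₚ.-‿cong (toℚᵘ-frac a b)) ⟩
  + n ℚᵘ./ N ℚᵘ.- + a ℚᵘ./ b
    ≈⟨ ℚᵘₚ.+-congˡ (ℚᵘ.- (+ a ℚᵘ./ b)) (ℚᵘₚ.*-cancelˡ-/ (suc k) {+ n}) ⟨
  (+ suc k ℤ.* + n) ℚᵘ./ b ℚᵘ.- + a ℚᵘ./ b
    ≈⟨ /-sub-/ (+ suc k ℤ.* + n) (+ a) b ⟩
  (+ suc k ℤ.* + n ℤ.- + a) ℚᵘ./ b ∎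
  where open ℚᵘₚ.≃-Reasoning

toℚᵘ-square : ∀ {p q} → toℚᵘ p ≃ᵘ q → toℚᵘ (p * p) ≃ᵘ q ℚᵘ.* q
toℚᵘ-square {p} p≃q = ℚᵘₚ.≃-trans (ℚₚ.toℚᵘ-homo-* p p) (ℚᵘₚ.*-cong p≃q p≃q)

module _ (n a k : ℕ) {N b : ℕ} .{{_ : NonZero N}} .{{_ : NonZero b}} (b≡kN : b ≡ k ℕ.* N) where

  private
    i : ℤ
    i = + k ℤ.* + n ℤ.- + a

    offset² radius² : ℚ
    offset² = (frac n N - frac a b) * (frac n N - frac a b)
    radius² = frac 1 b * frac 1 b

    toℚᵘ-offset² : toℚᵘ offset² ≃ᵘ (i ℚᵘ./ b) ℚᵘ.* (i ℚᵘ./ b)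
    toℚᵘ-offset² = toℚᵘ-square (toℚᵘ-frac-offset n a k b≡kN)

    toℚᵘ-radius² : toℚᵘ radius² ≃ᵘ (1ℤ ℚᵘ./ b) ℚᵘ.* (1ℤ ℚᵘ./ b)
    toℚᵘ-radius² = toℚᵘ-square (toℚᵘ-frac 1 b)

  frac-offset²-≤ : i ℤ.* i ℤ.≤ 1ℤ → offset² ≤ radius²
  frac-offset²-≤ i²≤1 = ℚₚ.toℚᵘ-cancel-≤ (begin
    toℚᵘ offset²                      ≃⟨ toℚᵘ-offset² ⟩
    (i ℚᵘ./ b) ℚᵘ.* (i ℚᵘ./ b)        ≤⟨ /-square-mono-≤ b i²≤1 ⟩
    (1ℤ ℚᵘ./ b) ℚᵘ.* (1ℤ ℚᵘ./ b)      ≃⟨ toℚᵘ-radius² ⟨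
    toℚᵘ radius²                      ∎)
    where open ℚᵘₚ.≤-Reasoning

  frac-offset²-≥ : 1ℤ ℤ.≤ i ℤ.* i → radius² ≤ offset²
  frac-offset²-≥ 1≤i² = ℚₚ.toℚᵘ-cancel-≤ (begin
    toℚᵘ radius²                      ≃⟨ toℚᵘ-radius² ⟩
    (1ℤ ℚᵘ./ b) ℚᵘ.* (1ℤ ℚᵘ./ b)      ≤⟨ /-square-mono-≤ b 1≤i² ⟩
    (i ℚᵘ./ b) ℚᵘ.* (i ℚᵘ./ b)        ≃⟨ toℚᵘ-offset² ⟨
    toℚᵘ offset²                      ∎)
    where open ℚᵘₚ.≤-Reasoning

dist²-to-real : ∀ x y p → dist² x y p 0ℚ ≡ (x - p) * (x - p) + y * y
dist²-to-real x y p = cong (λ t → (x - p) * (x - p) + t * t) (ℚₚ.+-identityʳ y)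

dist²-on-real-axis : ∀ x p → dist² x 0ℚ p 0ℚ ≡ (x - p) * (x - p)
dist²-on-real-axis x p = trans (dist²-to-real x 0ℚ p) (ℚₚ.+-identityʳ _)

dist²-vertical : ∀ x y → dist² x y x 0ℚ ≡ y * y
dist²-vertical x y = begin
  dist² x y x 0ℚ                 ≡⟨ dist²-to-real x y x ⟩
  (x - x) * (x - x) + y * y      ≡⟨ cong (λ t → t * t + y * y) (ℚₚ.+-inverseʳ x) ⟩
  0ℚ * 0ℚ + y * y                ≡⟨ ℚₚ.+-identityˡ (y * y) ⟩
  y * y                          ∎
  where open ≡-Reasoning

square-mono-< : ∀ {y ε} → 0ℚ ≤ y → y < ε → y * y < ε * ε
square-mono-< {y} {ε} 0≤y y<ε = ℚₚ.≤-<-trans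
  (ℚₚ.*-monoˡ-≤-nonNeg y {{ℚ.nonNegative 0≤y}} (ℚₚ.<⇒≤ y<ε))
  (ℚₚ.*-monoˡ-<-pos ε {{ℚ.positive (ℚₚ.≤-<-trans 0≤y y<ε)}} y<ε)

onBoundaryℛ-intro : ∀ {N x₀} → Inℛ N x₀ 0ℚ → (∀ {y} → 0ℚ < y → ¬ Inℛ N x₀ y) →
                    OnBoundaryℛ N x₀
onBoundaryℛ-intro {x₀ = x₀} x₀∈ℛ vertical∉ℛ ε 0<ε with ℚₚ.<-dense 0<ε
... | y , 0<y , y<ε = (x₀ , 0ℚ , near ℚₚ.≤-refl 0<ε , x₀∈ℛ)
                    , (x₀ , y , near (ℚₚ.<⇒≤ 0<y) y<ε , vertical∉ℛ 0<y)
  where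
  near : ∀ {t} → 0ℚ ≤ t → t < ε → dist² x₀ t x₀ 0ℚ < ε * ε
  near {t} 0≤t t<ε = subst (_< ε * ε) (sym (dist²-vertical x₀ t)) (square-mono-< 0≤t t<ε)

i-[1+i]≡-1 : ∀ i → i ℤ.- (1ℤ ℤ.+ i) ≡ ℤ.- 1ℤ
i-[1+i]≡-1 = solve-∀

[1+i]-i≡1 : ∀ i → (1ℤ ℤ.+ i) ℤ.- i ≡ 1ℤ
[1+i]-i≡1 = solve-∀

i≢0⇒1≤i*i : ∀ {i} → i ≢ 0ℤ → 1ℤ ℤ.≤ i ℤ.* i
i≢0⇒1≤i*i {+ zero}   i≢0 = contradiction refl i≢0
i≢0⇒1≤i*i {+ suc _}  _   = ℤ.+≤+ (ℕ.s≤s ℕ.z≤n)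
i≢0⇒1≤i*i { -[1+ _ ]} _  = ℤ.+≤+ (ℕ.s≤s ℕ.z≤n)

∈ℛ-of-offset : ∀ {N n} a k .{{_ : NonZero N}} .{{_ : NonZero k}} →
               a ℕ.≤ k ℕ.* N → Coprime a (k ℕ.* N) →
               (+ k ℤ.* + n ℤ.- + a) ℤ.* (+ k ℤ.* + n ℤ.- + a) ℤ.≤ 1ℤ →
               Inℛ N (frac n N) 0ℚ
∈ℛ-of-offset {N} {n} a k a≤b a⊥b i²≤1 =
  a , k ℕ.* N , (ℕ.>-nonZero⁻¹ (k ℕ.* N) , a≤b , a⊥b) , n∣m*n k ,
  subst (_≤ _) (sym (dist²-on-real-axis (frac n N) (frac a (k ℕ.* N))))
               (frac-offset²-≤ n a k refl i²≤1)
  where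
  instance
    kN≢0 : NonZero (k ℕ.* N)
    kN≢0 = ℕₚ.m*n≢0 k N

frac-∈ℛ : ∀ {N n} .{{_ : NonZero N}} → n ℕ.≤ N → Inℛ N (frac n N) 0ℚ
frac-∈ℛ {N@(suc _)} {n} n≤N with ℕₚ.m≤n⇒m<n∨m≡n n≤N
... | inj₁ n<N = ∈ℛ-of-offset {n = n} (suc (N ℕ.* n)) N (ℕₚ.*-monoʳ-< N n<N)
                   (coprime-* 1+Nn⊥N 1+Nn⊥N) (ℤₚ.≤-reflexive (cong (λ j → j ℤ.* j) offset≡-1))
  where
  1+Nn⊥N : Coprime (suc (N ℕ.* n)) N
  1+Nn⊥N = ∣⇒coprime-suc (m∣m*n n)
  offset≡-1 : + N ℤ.* + n ℤ.- + suc (N ℕ.* n) ≡ -1ℤ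
  offset≡-1 = trans (cong (ℤ._- + suc (N ℕ.* n)) (sym (ℤₚ.pos-* N n)))
                    (i-[1+i]≡-1 (+ (N ℕ.* n)))
... | inj₂ refl = ∈ℛ-of-offset {n = N} (ℕ.pred (N ℕ.* N)) N ℕₚ.pred[n]≤n
                    (Coprimality.sym (∣⇒coprime-suc ∣-refl))
                    (ℤₚ.≤-reflexive (cong (λ j → j ℤ.* j) offset≡1))
  where
  offset≡1 : + N ℤ.* + N ℤ.- + ℕ.pred (N ℕ.* N) ≡ 1ℤ
  offset≡1 = [1+i]-i≡1 (+ ℕ.pred (N ℕ.* N))

vertical-∉ℛ : ∀ {N n y} .{{_ : NonZero N}} → 1 ℕ.< gcd N n → 0ℚ < y → ¬ Inℛ N (frac n N) y
vertical-∉ℛ {N} {n} {y} 1<gcd 0<y (a , b , (0<b , _ , a⊥b) , divides k b≡kN , disk) =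
  ℚₚ.<-irrefl refl (ℚₚ.<-≤-trans radius²<dist² disk)
  where
  instance
    b≢0 : NonZero b
    b≢0 = ℕ.>-nonZero 0<b

  offset≢0 : + k ℤ.* + n ℤ.- + a ≢ 0ℤ
  offset≢0 offset≡0 = ℕₚ.<-irrefl (sym (coprime⇒gcd≡1 N⊥n)) 1<gcd
    where
    kn≡a : k ℕ.* n ≡ a
    kn≡a = ℤₚ.+-injective (trans (ℤₚ.pos-* k n) (ℤₚ.i-j≡0⇒i≡j _ _ offset≡0))
    N⊥n : Coprime N n
    N⊥n = Coprimality.sym (coprime-∣ (subst (n ∣_) kn≡a (n∣m*n k)) (divides k b≡kN) a⊥b)

  radius²<dist² : frac 1 b * frac 1 b < dist² (frac n N) y (frac a b) 0ℚ
  radius²<dist² = begin-strict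
    frac 1 b * frac 1 b
      ≡⟨ ℚₚ.+-identityʳ _ ⟨
    frac 1 b * frac 1 b + 0ℚ
      <⟨ ℚₚ.+-mono-≤-< (frac-offset²-≥ n a k b≡kN (i≢0⇒1≤i*i offset≢0))
                       (square-mono-< ℚₚ.≤-refl 0<y) ⟩
    (frac n N - frac a b) * (frac n N - frac a b) + y * y
      ≡⟨ dist²-to-real (frac n N) y (frac a b) ⟨
    dist² (frac n N) y (frac a b) 0ℚ ∎
    where open ℚₚ.≤-Reasoning

lemma2p1 : (N : ℕ) → 1 ℕ.< N → (n : ℕ) → n ℕ.≤ N → 1 ℕ.< gcd N n →
           OnBoundaryℛ N (frac n N)
lemma2p1 (suc N) _ n n≤N 1<gcd = onBoundaryℛ-intro (frac-∈ℛ n≤N) (vertical-∉ℛ {n = n} 1<gcd)
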